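{- The set $\mathrm{Sort}(\mathfrak{s}_{\underline{23}1})=\bigcup_{n\ge1}\mathrm{Sort}_n(\mathfrak{s}_{\underline{23}1})$ is not a permutation class: $25314\in\mathrm{Sort}(\mathfrak{s}_{\underline{23}1})$ contains $2413$, but $2413\notin\mathrm{Sort}(\mathfrak{s}_{\underline{23}1})$.
   Context: A permutation class is a set of permutations closed under (classical) pattern containment. A pattern is a permutation $\sigma$ in which some blocks of consecutive entries may be underlined; a sequence contains it if it has a subsequence order-isomorphic to $\sigma$ whose entries corresponding to a common underlined block are adjacent in the sequence. Pattern-avoiding stack map $\mathfrak{s}_\sigma$: process input $\tau_1,\dots,\tau_n$ in order; when $\tau_i$ is next, while the stack is nonempty and the sequence formed by placing $\tau_i$ on top of the stack, read top to bottom, contains $\sigma$ (underlined entries adjacent in the stack), pop the top entry to the output; then push $\tau_i$; at the end pop all remaining entries top to bottom to the output. $\mathrm{Sort}_n(\mathfrak{s}_\sigma)$ is the set of $\tau\in\mathfrak S_n$ such that $\mathfrak{s}_\sigma(\tau)$ avoids $231$. -}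

module Defs where

open import Data.Nat using (ℕ; zero; suc; _<_; _≥_)
open import Data.Fin using (Fin; cast)
open import Data.List using (List; []; _∷_; _++_; length; lookup; map; upTo; concat; [_])
open import Data.List.Relation.Binary.Permutation.Propositional using (_↭_)
open import Data.Product using (Σ; ∃; _×_; _,_)
open import Relation.Binary.PropositionalEquality using (_≡_)
open import Relation.Nullary using (¬_)

-- A sequence/permutation is a list of naturals.
-- Permutations of [n] = {1,…,n} in one-line notation.
IsPerm : ℕ → List ℕ → Set
IsPerm n w = w ↭ map suc (upTo n)

IsPermutation : List ℕ → Set
IsPermutation w = ∃ λ n → IsPerm n w

OrderIso : List ℕ → List ℕ → Set
OrderIso a b = Σ (length a ≡ length b) λ e →
  ∀ i j → ((lookup a i < lookup a j → lookup b (cast e i) < lookup b (cast e j))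
         × (lookup b (cast e i) < lookup b (cast e j) → lookup a i < lookup a j))

-- A (vincular) pattern: a list of blocks; the entries of each block are
-- underlined together (must be adjacent); a non-underlined entry is a
-- singleton block.  The pattern itself is the concatenation of the blocks.
Pattern : Set
Pattern = List (List ℕ)

data Occ : Pattern → List ℕ → List ℕ → Set where
  done : ∀ {w} → Occ [] w []
  skip : ∀ {P x w s} → Occ P w s → Occ P (x ∷ w) s
  take : ∀ {B P b w s} → length b ≡ length B → Occ P w s →
         Occ (B ∷ P) (b ++ w) (b ++ s)

ContainsPat : Pattern → List ℕ → Set
ContainsPat P w = ∃ λ s → Occ P w s × OrderIso s (concat P)

classical : List ℕ → Pattern
classical σ = map [_] σ

Contains : List ℕ → List ℕ → Set
Contains w σ = ContainsPat (classical σ) w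

Avoids : List ℕ → List ℕ → Set
Avoids w σ = ¬ Contains w σ

-- Pattern-avoiding stack map, as a big-step relation.
-- Run P inp st out : starting with remaining input inp and stack st
-- (written top first), the machine outputs out.
data Run (P : Pattern) : List ℕ → List ℕ → List ℕ → Set where
  finish : ∀ {st} → Run P [] st st
  pop    : ∀ {x inp y st out} →
           ContainsPat P (x ∷ y ∷ st) →
           Run P (x ∷ inp) st out →
           Run P (x ∷ inp) (y ∷ st) (y ∷ out)
  pushE  : ∀ {x inp out} →
           Run P inp (x ∷ []) out →
           Run P (x ∷ inp) [] out
  push   : ∀ {x inp y st out} →
           ¬ ContainsPat P (x ∷ y ∷ st) →
           Run P inp (x ∷ y ∷ st) out →
           Run P (x ∷ inp) (y ∷ st) out

StackMap : Pattern → List ℕ → List ℕ → Set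
StackMap P τ out = Run P τ [] out

pat-23-1 : Pattern
pat-23-1 = (2 ∷ 3 ∷ []) ∷ (1 ∷ []) ∷ []

Sort-n : Pattern → ℕ → List ℕ → Set
Sort-n P n τ = IsPerm n τ × ∃ λ out → StackMap P τ out × Avoids out (2 ∷ 3 ∷ 1 ∷ [])

SortAll : Pattern → List ℕ → Set
SortAll P τ = ∃ λ n → n ≥ 1 × Sort-n P n τ

IsPermClass : (List ℕ → Set) → Set
IsPermClass C = (∀ τ → C τ → IsPermutation τ) ×
  (∀ τ σ → C τ → IsPermutation σ → Contains τ σ → C σ)

{-# OPTIONS --safe #-}
-- The stack map is deterministic, so τ is sortable exactly when its unique output s(τ)
-- avoids 231, and containment of a vincular pattern is decidable by testing every
-- candidate occurrence for order-isomorphism. Evaluating, s(25314) = 54132 avoids 231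
-- while s(2413) = 3142 contains 231 (as 342); since 2514 is an occurrence of 2413 in
-- 25314, the sortable permutations are not closed under containment.
module Submission where

open import Defs
open import Data.Nat using (ℕ; zero; suc; _<_; _<?_; _≟_; _≥_; s≤s; z≤n)
open import Data.Nat.Properties using (≡-irrelevant; ≤-decTotalOrder)
open import Data.Fin using (cast)
open import Data.Fin.Properties using (all?)
open import Data.List using (List; []; _∷_; _++_; length; lookup; map; upTo; concat; [_])
open import Data.List.Membership.Propositional using (_∈_; find; lose)
open import Data.List.Membership.Propositional.Properties using (∈-map⁺; ∈-map⁻; ∈-++⁺ˡ; ∈-++⁺ʳ; ∈-++⁻)
open import Data.List.Relation.Binary.Permutation.Propositional using (_↭_; ↭-sym)
open import Data.List.Relation.Unary.Any using (Any; here; any?)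
open import Data.List.Sort.InsertionSort ≤-decTotalOrder using (sort)
open import Data.List.Sort.InsertionSort.Properties ≤-decTotalOrder using (sort-↭)
open import Data.Maybe using (Maybe; just; nothing)
import Data.Maybe as Maybe
open import Data.Product using (_×_; _,_; proj₁; proj₂; map₁)
open import Data.Sum using ([_,_]′)
open import Function using (_∘_; id)
open import Relation.Nullary using (¬_; Dec; yes; no; contradiction)
open import Relation.Nullary.Decidable using (map′; from-yes; from-no; _×-dec_; _→-dec_)
open import Relation.Binary.PropositionalEquality using (_≡_; refl; cong; subst)

splitPrefix : ℕ → List ℕ → Maybe (List ℕ × List ℕ)
splitPrefix zero    w       = just ([] , w)
splitPrefix (suc k) []      = nothing
splitPrefix (suc k) (x ∷ w) = Maybe.map (map₁ (x ∷_)) (splitPrefix k w)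

splitPrefix-++ : ∀ {k} b w → length b ≡ k → splitPrefix k (b ++ w) ≡ just (b , w)
splitPrefix-++ []      w refl = refl
splitPrefix-++ (x ∷ b) w refl rewrite splitPrefix-++ b w refl = refl

splitPrefix-just : ∀ k w {b r} → splitPrefix k w ≡ just (b , r) → length b ≡ k × w ≡ b ++ r
splitPrefix-just zero    w       refl = refl , refl
splitPrefix-just (suc k) (x ∷ w) eq with splitPrefix k w in eq′
splitPrefix-just (suc k) (x ∷ w) refl | just (b , r) with splitPrefix-just k w eq′
... | refl , refl = refl , refl

mutual
  occurrences : Pattern → List ℕ → List (List ℕ)
  occurrences []      w       = [ [] ]
  occurrences (B ∷ P) []      = occurrencesAtFront B P []
  occurrences (B ∷ P) (x ∷ w) = occurrencesAtFront B P (x ∷ w) ++ occurrences (B ∷ P) w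

  occurrencesAtFront : List ℕ → Pattern → List ℕ → List (List ℕ)
  occurrencesAtFront B P w with splitPrefix (length B) w
  ... | nothing      = []
  ... | just (b , r) = map (b ++_) (occurrences P r)

occurrencesAtFront⊆occurrences : ∀ B P w {s} → s ∈ occurrencesAtFront B P w → s ∈ occurrences (B ∷ P) w
occurrencesAtFront⊆occurrences B P []      = id
occurrencesAtFront⊆occurrences B P (x ∷ w) = ∈-++⁺ˡ

occurrencesAtFront-sound : ∀ B P w →
  (∀ r {s} → s ∈ occurrences P r → Occ P r s) →
  ∀ {s} → s ∈ occurrencesAtFront B P w → Occ (B ∷ P) w s
occurrencesAtFront-sound B P w P-sound s∈ with splitPrefix (length B) w in split
... | just (b , r) with splitPrefix-just (length B) w split | ∈-map⁻ (b ++_) s∈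
...   | length≡ , refl | _ , s′∈ , refl = take length≡ (P-sound r s′∈)

occurrences-sound : ∀ P w {s} → s ∈ occurrences P w → Occ P w s
occurrences-sound []      w       (here refl) = done
occurrences-sound (B ∷ P) []      s∈ = occurrencesAtFront-sound B P [] (occurrences-sound P) s∈
occurrences-sound (B ∷ P) (x ∷ w) s∈ =
  [ occurrencesAtFront-sound B P (x ∷ w) (occurrences-sound P)
  , skip ∘ occurrences-sound (B ∷ P) w
  ]′ (∈-++⁻ (occurrencesAtFront B P (x ∷ w)) s∈)

occurrences-complete : ∀ {P w s} → Occ P w s → s ∈ occurrences P w
occurrences-complete done = here refl
occurrences-complete {[]}    (skip o) = occurrences-complete o
occurrences-complete {B ∷ P} (skip o) = ∈-++⁺ʳ _ (occurrences-complete o)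
occurrences-complete (take {B} {P} {b} {w} length≡ o) =
  occurrencesAtFront⊆occurrences B P (b ++ w) atFront
  where
  atFront : _ ∈ occurrencesAtFront B P (b ++ w)
  atFront rewrite splitPrefix-++ b w length≡ = ∈-map⁺ (b ++_) (occurrences-complete o)

SameOrder : (a b : List ℕ) → length a ≡ length b → Set
SameOrder a b e = ∀ i j → ((lookup a i < lookup a j → lookup b (cast e i) < lookup b (cast e j))
                        × (lookup b (cast e i) < lookup b (cast e j) → lookup a i < lookup a j))

sameOrder? : ∀ a b e → Dec (SameOrder a b e)
sameOrder? a b e = all? λ i → all? λ j →
  ((lookup a i <? lookup a j) →-dec (lookup b (cast e i) <? lookup b (cast e j)))
  ×-dec ((lookup b (cast e i) <? lookup b (cast e j)) →-dec (lookup a i <? lookup a j))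

orderIso? : ∀ a b → Dec (OrderIso a b)
orderIso? a b with length a ≟ length b
... | no  length≢ = no (length≢ ∘ proj₁)
... | yes length≡ = map′ (length≡ ,_) fromOrderIso (sameOrder? a b length≡)
  where
  fromOrderIso : OrderIso a b → SameOrder a b length≡
  fromOrderIso (e , same) = subst (SameOrder a b) (≡-irrelevant e length≡) same

containsPat? : ∀ P w → Dec (ContainsPat P w)
containsPat? P w = map′ fromAny toAny (any? (λ s → orderIso? s (concat P)) (occurrences P w))
  where
  fromAny : Any (λ s → OrderIso s (concat P)) (occurrences P w) → ContainsPat P w
  fromAny iso∈ = let s , s∈ , iso = find iso∈ in s , occurrences-sound P w s∈ , iso
  toAny : ContainsPat P w → Any (λ s → OrderIso s (concat P)) (occurrences P w)
  toAny (s , o , iso) = lose (occurrences-complete o) iso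

contains? : ∀ w σ → Dec (Contains w σ)
contains? w σ = containsPat? (classical σ) w

popWhile : Pattern → ℕ → List ℕ → List ℕ × List ℕ
popWhile P x []       = [] , []
popWhile P x (y ∷ st) with containsPat? P (x ∷ y ∷ st)
... | yes _ = map₁ (y ∷_) (popWhile P x st)
... | no  _ = [] , y ∷ st

stackRun : Pattern → List ℕ → List ℕ → List ℕ
stackRun P []        st = st
stackRun P (x ∷ inp) st = proj₁ (popWhile P x st) ++ stackRun P inp (x ∷ proj₂ (popWhile P x st))

run-popWhile : ∀ {P x inp out} st → Run P inp (x ∷ proj₂ (popWhile P x st)) out →
               Run P (x ∷ inp) st (proj₁ (popWhile P x st) ++ out)
run-popWhile []       r = pushE r
run-popWhile {P} {x} (y ∷ st) r with containsPat? P (x ∷ y ∷ st)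
... | yes occurs  = pop occurs (run-popWhile st r)
... | no  ¬occurs = push ¬occurs r

run-stackRun : ∀ P inp st → Run P inp st (stackRun P inp st)
run-stackRun P []        st = finish
run-stackRun P (x ∷ inp) st = run-popWhile st (run-stackRun P inp _)

run⇒≡stackRun : ∀ {P inp st out} → Run P inp st out → out ≡ stackRun P inp st
run⇒≡stackRun finish = refl
run⇒≡stackRun (pushE r) = run⇒≡stackRun r
run⇒≡stackRun {P} (pop {x} {_} {y} {st} occurs r) with containsPat? P (x ∷ y ∷ st)
... | yes _       = cong (y ∷_) (run⇒≡stackRun r)
... | no ¬occurs  = contradiction occurs ¬occurs
run⇒≡stackRun {P} (push {x} {_} {y} {st} ¬occurs r) with containsPat? P (x ∷ y ∷ st)
... | yes occurs = contradiction occurs ¬occurs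
... | no _       = run⇒≡stackRun r

sortAll⇒avoids : ∀ {P τ out} → SortAll P τ → stackRun P τ [] ≡ out → Avoids out (2 ∷ 3 ∷ 1 ∷ [])
sortAll⇒avoids (_ , _ , _ , _ , run , avoids) refl rewrite run⇒≡stackRun run = avoids

avoids⇒sortAll : ∀ {P τ out} n → n ≥ 1 → IsPerm n τ →
                 stackRun P τ [] ≡ out → Avoids out (2 ∷ 3 ∷ 1 ∷ []) → SortAll P τ
avoids⇒sortAll n n≥1 perm refl avoids = n , n≥1 , perm , _ , run-stackRun _ _ [] , avoids

isPerm-bySorting : ∀ n w → sort w ≡ map suc (upTo n) → IsPerm n w
isPerm-bySorting n w sorted = subst (w ↭_) sorted (↭-sym (sort-↭ w))

¬IsPermClass : ∀ {C : List ℕ → Set} τ σ → C τ → IsPermutation σ → Contains τ σ → ¬ C σ → ¬ IsPermClass C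
¬IsPermClass τ σ τ∈C σ-perm τ⊇σ σ∉C (_ , closed) = σ∉C (closed τ σ τ∈C σ-perm τ⊇σ)

stackRun-25314 : stackRun pat-23-1 (2 ∷ 5 ∷ 3 ∷ 1 ∷ 4 ∷ []) [] ≡ 5 ∷ 4 ∷ 1 ∷ 3 ∷ 2 ∷ []
stackRun-25314 = refl

stackRun-2413 : stackRun pat-23-1 (2 ∷ 4 ∷ 1 ∷ 3 ∷ []) [] ≡ 3 ∷ 1 ∷ 4 ∷ 2 ∷ []
stackRun-2413 = refl

sortable-25314 : SortAll pat-23-1 (2 ∷ 5 ∷ 3 ∷ 1 ∷ 4 ∷ [])
sortable-25314 = avoids⇒sortAll 5 (s≤s z≤n) (isPerm-bySorting 5 _ refl) stackRun-25314
  (from-no (contains? (5 ∷ 4 ∷ 1 ∷ 3 ∷ 2 ∷ []) (2 ∷ 3 ∷ 1 ∷ [])))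

unsortable-2413 : ¬ SortAll pat-23-1 (2 ∷ 4 ∷ 1 ∷ 3 ∷ [])
unsortable-2413 sortable =
  sortAll⇒avoids sortable stackRun-2413 (from-yes (contains? (3 ∷ 1 ∷ 4 ∷ 2 ∷ []) (2 ∷ 3 ∷ 1 ∷ [])))

25314-contains-2413 : Contains (2 ∷ 5 ∷ 3 ∷ 1 ∷ 4 ∷ []) (2 ∷ 4 ∷ 1 ∷ 3 ∷ [])
25314-contains-2413 = from-yes (contains? (2 ∷ 5 ∷ 3 ∷ 1 ∷ 4 ∷ []) (2 ∷ 4 ∷ 1 ∷ 3 ∷ []))

mainTheorem12 : ¬ IsPermClass (SortAll pat-23-1)
    × SortAll pat-23-1 (2 ∷ 5 ∷ 3 ∷ 1 ∷ 4 ∷ [])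
    × Contains (2 ∷ 5 ∷ 3 ∷ 1 ∷ 4 ∷ []) (2 ∷ 4 ∷ 1 ∷ 3 ∷ [])
    × ¬ SortAll pat-23-1 (2 ∷ 4 ∷ 1 ∷ 3 ∷ [])
mainTheorem12 =
  ¬IsPermClass _ _ sortable-25314 (4 , isPerm-bySorting 4 _ refl) 25314-contains-2413 unsortable-2413 ,
  sortable-25314 , 25314-contains-2413 , unsortable-2413
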